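{- Let $f,g,s,z$ be distinct alternatives and let $\mathcal D\subseteq\mathcal L(\{f,g,s,z\})$ be a peak-pit Condorcet domain with $R=sfgz\in\mathcal D$ and $T\in\mathcal D$ where $T\in\{zgsf,zgfs\}$, and such that $gN_{\{f,g,z\}}1\in N_p(\mathcal D_{\{f,g,z\}})$. Let $\mathcal G=(G_1,\dots,G_k)$ be a geodesic on $\mathcal L(\{f,g,s\})$ connecting $R_{\{f,g,s\}}$ and $T_{\{f,g,s\}}$ such that $\mathcal D_{\{f,g,s\}}\cup\{G_1,\dots,G_k\}$ is a peak-pit Condorcet domain and $(f,g)$ is the first switching pair in $S(\mathcal G)$. Then $gN_{\{g,s,z\}}1\in N_p(\mathcal D_{\{g,s,z\}})$.
   Context: Linear orders are written as words from top to bottom; $\mathcal D_B$ is the set of restrictions of orders of $\mathcal D$ to $B$. For distinct $p,q,r$, $x\in\{p,q,r\}$, $k\in\{1,2,3\}$, a domain satisfies the never-condition $xN_{\{p,q,r\}}k$ if none of its orders restricted to $\{p,q,r\}$ has $x$ in position $k$; those with $k=1$ (never-top) or $k=3$ (never-bottom) are peak-pit conditions, and $N_p(\cdot)$ is the set of peak-pit conditions satisfied. A peak-pit Condorcet domain is a domain whose restriction to every triple of distinct alternatives satisfies at least one peak-pit condition. Two orders are alike if they differ by swapping two adjacent alternatives $x,y$ (switching pair $(x,y)$); a geodesic is a path of alike orders of minimum length between its endpoints, and $S(\mathcal G)$ is its sequence of switching pairs. -}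

module Defs where

open import Data.Nat using (ℕ; zero; suc; _≤_)
open import Data.List using (List; []; _∷_; _++_; map; filter; length)
open import Data.List.Membership.Propositional using (_∈_)
open import Data.List.Relation.Unary.All using (All)
open import Data.List.Relation.Binary.Permutation.Propositional using (_↭_)
open import Data.Product using (Σ; ∃; _×_; _,_)
open import Data.Sum using (_⊎_)
open import Data.Empty using (⊥)
open import Relation.Nullary using (¬_; Dec; yes; no)
open import Relation.Binary.PropositionalEquality using (_≡_; _≢_; refl)
import Data.List.Membership.DecPropositional as DecMem

data Alt : Set where
  f g s z : Alt

_≟_ : (x y : Alt) → Dec (x ≡ y)
f ≟ f = yes refl
f ≟ g = no λ ()
f ≟ s = no λ ()
f ≟ z = no λ ()
g ≟ f = no λ ()
g ≟ g = yes refl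
g ≟ s = no λ ()
g ≟ z = no λ ()
s ≟ f = no λ ()
s ≟ g = no λ ()
s ≟ s = yes refl
s ≟ z = no λ ()
z ≟ f = no λ ()
z ≟ g = no λ ()
z ≟ s = no λ ()
z ≟ z = yes refl

open DecMem _≟_ using (_∈?_)

-- A linear order is written as a word, from top to bottom.
Word : Set
Word = List Alt

-- w is a linear order on the set X (X given as a duplicate-free list).
LinOrd : List Alt → Word → Set
LinOrd X w = w ↭ X

restrict : List Alt → Word → Word
restrict B w = filter (λ x → x ∈? B) w

restrictDom : List Alt → List Word → List Word
restrictDom B D = map (restrict B) D

-- At w k x : x is in position k (1-indexed, from the top) of w.
At : Word → ℕ → Alt → Set
At [] _ _ = ⊥
At (y ∷ w) zero x = ⊥
At (y ∷ w) (suc zero) x = y ≡ x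
At (y ∷ w) (suc (suc k)) x = At w (suc k) x

-- Never-condition x N_B k : no order of D restricted to B has x in position k.
Never : List Word → Alt → List Alt → ℕ → Set
Never D x B k = ∀ w → w ∈ D → ¬ At (restrict B w) k x

-- Peak-pit Condorcet domain on the set X: D ⊆ L(X), and every triple of
-- distinct alternatives satisfies some never-top or never-bottom condition.
PeakPitCD : List Alt → List Word → Set
PeakPitCD X D =
  All (LinOrd X) D ×
  (∀ p q r → p ∈ X → q ∈ X → r ∈ X → p ≢ q → q ≢ r → p ≢ r →
    ∃ λ x → x ∈ (p ∷ q ∷ r ∷ []) × ∃ λ k → (k ≡ 1 ⊎ k ≡ 3) ×
      Never D x (p ∷ q ∷ r ∷ []) k)

Swap : Alt → Alt → Word → Word → Set
Swap x y w w' = Σ Word λ u → Σ Word λ v →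
  (w ≡ u ++ (x ∷ y ∷ v)) × (w' ≡ u ++ (y ∷ x ∷ v))

Alike : Word → Word → Set
Alike w w' = ∃ λ x → ∃ λ y → Swap x y w w'

data PathFrom : Word → Word → List Word → Set where
  stop : ∀ {a} → PathFrom a a (a ∷ [])
  step : ∀ {a b c ws} → Alike a b → PathFrom b c ws → PathFrom a c (a ∷ ws)

Geodesic : List Alt → Word → Word → List Word → Set
Geodesic X a b ws =
  PathFrom a b ws × All (LinOrd X) ws ×
  (∀ vs → PathFrom a b vs → All (LinOrd X) vs → length ws ≤ length vs)

FirstSwitch : Alt → Alt → List Word → Set
FirstSwitch x y (w₁ ∷ w₂ ∷ _) = Swap x y w₁ w₂
FirstSwitch x y _ = ⊥

{-# OPTIONS --safe #-}
module Submission where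

-- If some order of D put g above s and z, then, since g is never top on {f, g, z},
-- f would lie above g and the order would restrict to fgs on {f, g, s}.  Together
-- with R = sfg, the second order sgf of the geodesic (its first switch is (f, g))
-- and T, which has g on top of {f, g, s}, every peak-pit condition on {f, g, s}
-- fails: fgs and its reverse sgf rule out those on f and s, T and sfg those on g.

open import Defs
open import Data.Nat using (zero; suc)
open import Data.Nat.Properties using (suc-injective)
open import Data.List using (List; []; _∷_; _++_; length)
open import Data.List.Properties using (filter-idem; ≡-dec)
open import Data.List.Membership.Propositional using (_∈_)
open import Data.List.Membership.Propositional.Properties using (∈-map⁻; ∈-map⁺; ∈-++⁺ˡ; ∈-++⁺ʳ)
open import Data.List.Membership.DecPropositional _≟_ using (_∈?_)
open import Data.List.Relation.Unary.Any using (here; there)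
open import Data.List.Relation.Unary.All as All using ()
open import Data.List.Relation.Binary.Permutation.Propositional using (_↭_; ↭-sym)
open import Data.List.Relation.Binary.Permutation.Propositional.Properties using (∈-resp-↭; ↭-length)
open import Data.Product using (_×_; _,_; ∃-syntax)
open import Data.Sum using (_⊎_; inj₁; inj₂)
open import Function using (_∘_)
open import Relation.Nullary using (¬_; Dec; no)
open import Relation.Nullary.Decidable using (_×-dec_; _→-dec_; ¬?; map′; from-yes)
open import Relation.Binary.PropositionalEquality using (_≡_; refl; sym; cong; subst)

all-Alt? : {P : Alt → Set} → (∀ x → Dec (P x)) → Dec (∀ x → P x)
all-Alt? P? = map′
  (λ { (pf , pg , ps , pz) → λ { f → pf ; g → pg ; s → ps ; z → pz } })
  (λ ∀P → ∀P f , ∀P g , ∀P s , ∀P z)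
  (P? f ×-dec P? g ×-dec P? s ×-dec P? z)

all-words? : {P : Word → Set} → (∀ w → Dec (P w)) →
  ∀ n → Dec (∀ w → length w ≡ n → P w)
all-words? P? zero = map′ (λ P[] → λ { [] refl → P[] }) (λ ∀P → ∀P [] refl) (P? [])
all-words? P? (suc n) = map′
  (λ ∀P → λ { (a ∷ w) |w|≡n → ∀P a w (suc-injective |w|≡n) })
  (λ ∀P a w |w|≡n → ∀P (a ∷ w) (cong suc |w|≡n))
  (all-Alt? λ a → all-words? (P? ∘ (a ∷_)) n)

At? : ∀ w k x → Dec (At w k x)
At? [] _ _ = no λ ()
At? (y ∷ w) zero x = no λ ()
At? (y ∷ w) (suc zero) x = y ≟ x
At? (y ∷ w) (suc (suc k)) x = At? w (suc k) x

restrict-idem : ∀ B w → restrict B (restrict B w) ≡ restrict B w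
restrict-idem B = filter-idem (_∈? B)

Never-restrictDom⁻ : ∀ {D x B k} → Never (restrictDom B D) x B k →
  ∀ {w} → w ∈ D → ¬ At (restrict B w) k x
Never-restrictDom⁻ {x = x} {B} {k} never {w} w∈D =
  subst (λ v → ¬ At v k x) (restrict-idem B w) (never _ (∈-map⁺ (restrict B) w∈D))

Never-restrictDom⁺ : ∀ {D x B k} → (∀ {w} → w ∈ D → ¬ At (restrict B w) k x) →
  Never (restrictDom B D) x B k
Never-restrictDom⁺ {x = x} {B} {k} never v v∈D[B] with ∈-map⁻ (restrict B) v∈D[B]
... | w , w∈D , refl = subst (λ u → ¬ At u k x) (sym (restrict-idem B w)) (never w∈D)

PeakPitTriple : List Word → Alt → Alt → Alt → Set
PeakPitTriple D p q r = ∃[ x ] x ∈ (p ∷ q ∷ r ∷ []) × ∃[ k ] (k ≡ 1 ⊎ k ≡ 3) ×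
  Never D x (p ∷ q ∷ r ∷ []) k

PeakPitCD⇒PeakPitTriple : ∀ {D} → PeakPitCD (f ∷ g ∷ s ∷ []) D → PeakPitTriple D f g s
PeakPitCD⇒PeakPitTriple (_ , peak-pit) = peak-pit f g s
  (here refl) (there (here refl)) (there (there (here refl))) (λ ()) (λ ()) (λ ())

¬PeakPitTriple-fgs : ∀ {E t} →
  (f ∷ g ∷ s ∷ []) ∈ E → (s ∷ g ∷ f ∷ []) ∈ E → (s ∷ f ∷ g ∷ []) ∈ E →
  t ∈ E → At (restrict (f ∷ g ∷ s ∷ []) t) 1 g → ¬ PeakPitTriple E f g s
¬PeakPitTriple-fgs fgs∈E sgf∈E sfg∈E t∈E g-top-t (x , x∈fgs , k , k∈13 , never)
  with x∈fgs | k∈13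
... | here refl                 | inj₁ refl = never _ fgs∈E refl
... | here refl                 | inj₂ refl = never _ sgf∈E refl
... | there (here refl)         | inj₁ refl = never _ t∈E g-top-t
... | there (here refl)         | inj₂ refl = never _ sfg∈E refl
... | there (there (here refl)) | inj₁ refl = never _ sfg∈E refl
... | there (there (here refl)) | inj₂ refl = never _ fgs∈E refl

FGSZ : List Alt
FGSZ = f ∷ g ∷ s ∷ z ∷ []

restrict-fgs-of-g-top-gsz : ∀ w → w ↭ FGSZ →
  At (restrict (g ∷ s ∷ z ∷ []) w) 1 g → ¬ At (restrict (f ∷ g ∷ z ∷ []) w) 1 g →
  restrict (f ∷ g ∷ s ∷ []) w ≡ f ∷ g ∷ s ∷ []
restrict-fgs-of-g-top-gsz w w↭fgsz = from-yes (all-words? P? 4) w (↭-length w↭fgsz)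
  (∈-fgsz (here refl)) (∈-fgsz (there (here refl)))
  (∈-fgsz (there (there (here refl)))) (∈-fgsz (there (there (there (here refl)))))
  where
  ∈-fgsz : ∀ {x} → x ∈ FGSZ → x ∈ w
  ∈-fgsz = ∈-resp-↭ (↭-sym w↭fgsz)
  P? : ∀ v → Dec (f ∈ v → g ∈ v → s ∈ v → z ∈ v →
    At (restrict (g ∷ s ∷ z ∷ []) v) 1 g → ¬ At (restrict (f ∷ g ∷ z ∷ []) v) 1 g →
    restrict (f ∷ g ∷ s ∷ []) v ≡ f ∷ g ∷ s ∷ [])
  P? v = f ∈? v →-dec g ∈? v →-dec s ∈? v →-dec z ∈? v →-dec
    At? (restrict (g ∷ s ∷ z ∷ []) v) 1 g →-dec ¬? (At? (restrict (f ∷ g ∷ z ∷ []) v) 1 g) →-dec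
    ≡-dec _≟_ (restrict (f ∷ g ∷ s ∷ []) v) (f ∷ g ∷ s ∷ [])

PathFrom-head : ∀ {a b w ws} → PathFrom a b (w ∷ ws) → w ≡ a
PathFrom-head stop = refl
PathFrom-head (step _ _) = refl

FirstSwitch⇒second : ∀ {x y a b ws} → PathFrom a b ws → FirstSwitch x y ws →
  ∃[ w ] w ∈ ws × Swap x y a w
FirstSwitch⇒second {ws = w₁ ∷ w₂ ∷ _} path swap with PathFrom-head path
... | refl = w₂ , there (here refl) , swap

Swap-fg-sfg : ∀ {w} → Swap f g (s ∷ f ∷ g ∷ []) w → w ≡ s ∷ g ∷ f ∷ []
Swap-fg-sfg (_ ∷ [] , [] , refl , w≡) = w≡
Swap-fg-sfg ([] , _ , () , _)
Swap-fg-sfg (_ ∷ [] , _ ∷ _ , () , _)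
Swap-fg-sfg (_ ∷ _ ∷ [] , _ , () , _)
Swap-fg-sfg (_ ∷ _ ∷ _ ∷ [] , _ , () , _)
Swap-fg-sfg (_ ∷ _ ∷ _ ∷ _ ∷ _ , _ , () , _)

lemma18 : (D : List Word) (T : Word) (G : List Word) →
    PeakPitCD (f ∷ g ∷ s ∷ z ∷ []) D →
    (s ∷ f ∷ g ∷ z ∷ []) ∈ D →
    T ∈ D →
    (T ≡ (z ∷ g ∷ s ∷ f ∷ []) ⊎ T ≡ (z ∷ g ∷ f ∷ s ∷ [])) →
    Never (restrictDom (f ∷ g ∷ z ∷ []) D) g (f ∷ g ∷ z ∷ []) 1 →
    Geodesic (f ∷ g ∷ s ∷ []) (restrict (f ∷ g ∷ s ∷ []) (s ∷ f ∷ g ∷ z ∷ []))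
      (restrict (f ∷ g ∷ s ∷ []) T) G →
    PeakPitCD (f ∷ g ∷ s ∷ []) (restrictDom (f ∷ g ∷ s ∷ []) D ++ G) →
    FirstSwitch f g G →
    Never (restrictDom (g ∷ s ∷ z ∷ []) D) g (g ∷ s ∷ z ∷ []) 1
lemma18 D T G (D-lin , _) R∈D T∈D T-shape g-not-top-fgz (path , _) DG-peak-pit first-fg =
  Never-restrictDom⁺ λ {w} w∈D g-top-gsz →
    ¬PeakPitTriple-fgs
      (subst (_∈ E)
        (restrict-fgs-of-g-top-gsz w (All.lookup D-lin w∈D) g-top-gsz
          (Never-restrictDom⁻ g-not-top-fgz w∈D))
        (∈-D w∈D))
      (∈-++⁺ʳ _ sgf∈G) (∈-D R∈D) (∈-D T∈D) (g-top-T T-shape)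
      (PeakPitCD⇒PeakPitTriple DG-peak-pit)
  where
  E : List Word
  E = restrictDom (f ∷ g ∷ s ∷ []) D ++ G
  ∈-D : ∀ {w} → w ∈ D → restrict (f ∷ g ∷ s ∷ []) w ∈ E
  ∈-D = ∈-++⁺ˡ ∘ ∈-map⁺ (restrict (f ∷ g ∷ s ∷ []))
  sgf∈G : (s ∷ g ∷ f ∷ []) ∈ G
  sgf∈G with FirstSwitch⇒second path first-fg
  ... | w , w∈G , swap = subst (_∈ G) (Swap-fg-sfg swap) w∈G
  g-top-T : T ≡ (z ∷ g ∷ s ∷ f ∷ []) ⊎ T ≡ (z ∷ g ∷ f ∷ s ∷ []) →
    At (restrict (f ∷ g ∷ s ∷ []) (restrict (f ∷ g ∷ s ∷ []) T)) 1 g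
  g-top-T (inj₁ refl) = refl
  g-top-T (inj₂ refl) = refl
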